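{- For $n\ge1$ let $g_n$ be the number of Grand-Dyck paths of semilength $n$ starting with an up step and avoiding the pattern $DUD$. Then \[\sum_{n\ge1} g_n z^n=\frac{1-3z-\sqrt{1-2z-3z^2}}{6z-2},\] i.e. $(g_n)$ is the sequence A005773 of the OEIS ($1,2,5,13,35,\dots$).
   Context: A Grand-Dyck path of semilength $n$ starting with an up step is a word with $n$ letters $U$ (step $(1,1)$) and $n$ letters $D$ (step $(1,-1)$) whose first letter is $U$. It avoids the pattern $DUD$ if the word contains no three consecutive letters $D,U,D$. -}

module Defs where

open import Data.Nat using (ℕ; zero; suc; _+_; _*_; _∸_; _≡ᵇ_)
open import Data.Integer as ℤ using (ℤ; +_; -_)
open import Data.Bool using (Bool; true; false; _∧_; not)
open import Data.List using (List; []; _∷_; length; filter; map; _++_; concatMap)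
open import Relation.Nullary.Decidable using (yes; no)
open import Relation.Binary.PropositionalEquality using (_≡_; refl)
open import Data.Bool.Properties using () renaming (_≟_ to _≟B_)

data Step : Set where
  U D : Step

words : ℕ → List (List Step)
words zero    = [] ∷ []
words (suc k) = concatMap (λ w → (U ∷ w) ∷ (D ∷ w) ∷ []) (words k)

countU countD : List Step → ℕ
countU []       = 0
countU (U ∷ w)  = suc (countU w)
countU (D ∷ w)  = countU w
countD []       = 0
countD (D ∷ w)  = suc (countD w)
countD (U ∷ w)  = countD w

startsWithU : List Step → Bool
startsWithU (U ∷ _) = true
startsWithU _       = false

containsDUD : List Step → Bool
containsDUD (D ∷ U ∷ D ∷ w) = true
containsDUD (_ ∷ w)         = containsDUD w
containsDUD []              = false

valid : ℕ → List Step → Bool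
valid n w = (countU w ≡ᵇ n) ∧ (countD w ≡ᵇ n) ∧ startsWithU w ∧ not (containsDUD w)

g : ℕ → ℕ
g n = length (filter (λ w → valid n w ≟B true) (words (n + n)))

Series : Set
Series = ℕ → ℤ

sumTo : ℕ → (ℕ → ℤ) → ℤ
sumTo zero    f = f 0
sumTo (suc n) f = sumTo n f ℤ.+ f (suc n)

_⋆_ : Series → Series → Series
(a ⋆ b) n = sumTo n (λ k → a k ℤ.* b (n ∸ k))

_⊖_ : Series → Series → Series
(a ⊖ b) n = a n ℤ.- b n

poly : List ℤ → Series
poly []       _       = + 0
poly (c ∷ cs) zero    = c
poly (c ∷ cs) (suc n) = poly cs n

G : Series
G zero    = + 0
G (suc n) = + g (suc n)

disc : Series
disc = poly (+ 1 ∷ - (+ 2) ∷ - (+ 3) ∷ [])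

denom : Series
denom = poly (- (+ 2) ∷ + 6 ∷ [])

numer₀ : Series
numer₀ = poly (+ 1 ∷ - (+ 3) ∷ [])

IsSqrtDisc : Series → Set
IsSqrtDisc S = (S 0 ≡ + 1) × ((n : ℕ) → (S ⋆ S) n ≡ disc n)
  where open import Data.Product using (_×_)

-- Read a word from left to right while remembering whether it currently ends in D or in DU;
-- a down step is forbidden exactly after DU. A path starting with U, cut at its first step
-- below height 0, is a nonnegative excursion followed by nothing or by a path starting
-- with D; symmetrically for paths starting with D. The series of nonnegative and of
-- nonpositive excursions both solve E = z (1 + E + E²), whose solution is unique, so the
-- series G of paths starting with U and G′ of paths starting with D satisfy G = E (1 + G′)
-- and G′ = E (1 + G), whence G = G′ = E (1 + G). Eliminating E gives
-- (1 - 3z)(1 + 2G)² = 1 + z, so (1 - 3z)(1 + 2G) is the square root of 1 - 2z - 3z² with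
-- constant term 1, and such a square root is unique.
module Submission where

open import Algebra using (CommutativeRing)
open import Algebra.Structures using (IsAbelianGroup)
import Algebra.Solver.Ring.AlmostCommutativeRing as ACR
open import Data.Bool using (Bool; true; false; _∧_; not)
open import Data.Bool.Properties using (∧-zeroʳ) renaming (_≟_ to _≟B_)
open import Data.Integer using (ℤ; +_; -_; _+_; _*_; 0ℤ; 1ℤ)
open import Data.Integer.Tactic.RingSolver using (solve-∀)
import Data.Integer.Properties as ℤ
open import Data.List using (List; []; _∷_; _++_; length; filter; concatMap)
open import Data.Maybe using (Maybe; just; nothing)
open import Data.Nat as ℕ using (ℕ; zero; suc; _∸_; _≤_; _≡ᵇ_; z≤n; s≤s)
import Data.Nat.Properties as ℕ
open import Data.Product using (_,_)
open import Data.Sum using (inj₁; inj₂)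
open import Function using (_∘_)
open import Level using (0ℓ)
open import Relation.Binary using (Setoid)
open import Relation.Binary.PropositionalEquality
import Relation.Binary.Reasoning.Setoid as SetoidReasoning
open import Relation.Nullary using (yes; no; contradiction)

open import Algebra.Properties.CommutativeSemigroup ℤ.+-commutativeSemigroup
  using (interchange; x∙yz≈yx∙z)

open import Defs

-- Finite sums

sumTo-cong : ∀ n {f f′ : ℕ → ℤ} → (∀ {k} → k ≤ n → f k ≡ f′ k) →
             sumTo n f ≡ sumTo n f′
sumTo-cong zero    f≡f′ = f≡f′ z≤n
sumTo-cong (suc n) f≡f′ =
  cong₂ _+_ (sumTo-cong n (f≡f′ ∘ ℕ.m≤n⇒m≤1+n)) (f≡f′ ℕ.≤-refl)

sumTo-zero : ∀ n → sumTo n (λ _ → 0ℤ) ≡ 0ℤ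
sumTo-zero zero    = refl
sumTo-zero (suc n) = cong (_+ 0ℤ) (sumTo-zero n)

sumTo-+ : ∀ n (f f′ : ℕ → ℤ) → sumTo n (λ k → f k + f′ k) ≡ sumTo n f + sumTo n f′
sumTo-+ zero    f f′ = refl
sumTo-+ (suc n) f f′ = trans (cong (_+ (f (suc n) + f′ (suc n))) (sumTo-+ n f f′))
                             (interchange (sumTo n f) (sumTo n f′) (f (suc n)) (f′ (suc n)))

sumTo-*ˡ : ∀ n c (f : ℕ → ℤ) → sumTo n (λ k → c * f k) ≡ c * sumTo n f
sumTo-*ˡ zero    c f = refl
sumTo-*ˡ (suc n) c f = trans (cong (_+ c * f (suc n)) (sumTo-*ˡ n c f))
                             (sym (ℤ.*-distribˡ-+ c (sumTo n f) (f (suc n))))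

sumTo-suc : ∀ n (f : ℕ → ℤ) → sumTo (suc n) f ≡ f 0 + sumTo n (f ∘ suc)
sumTo-suc zero    f = refl
sumTo-suc (suc n) f = trans (cong (_+ f (suc (suc n))) (sumTo-suc n f))
                            (ℤ.+-assoc (f 0) _ _)

sumTo-reverse : ∀ n (f : ℕ → ℤ) → sumTo n f ≡ sumTo n (λ k → f (n ∸ k))
sumTo-reverse zero    f = refl
sumTo-reverse (suc n) f = begin
  sumTo n f + f (suc n)                     ≡⟨ cong (_+ f (suc n)) (sumTo-reverse n f) ⟩
  sumTo n (λ k → f (n ∸ k)) + f (suc n)     ≡⟨ ℤ.+-comm _ (f (suc n)) ⟩
  f (suc n) + sumTo n (λ k → f (n ∸ k))     ≡⟨ sumTo-suc n (λ k → f (suc n ∸ k)) ⟨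
  sumTo (suc n) (λ k → f (suc n ∸ k))       ∎
  where open ≡-Reasoning

-- The ring of formal power series

infixl 6 _⊕_
infix  8 ⊝_
infixr 7 _·_

𝟘 : Series
𝟘 _ = 0ℤ

const : ℤ → Series
const c zero    = c
const c (suc _) = 0ℤ

𝟙 : Series
𝟙 = const 1ℤ

_⊕_ : Series → Series → Series
(a ⊕ b) n = a n + b n

⊝_ : Series → Series
(⊝ a) n = - a n

_·_ : ℤ → Series → Series
(c · a) n = c * a n

shift : Series → Series
shift a zero    = 0ℤ
shift a (suc n) = a n

tail : Series → Series
tail a n = a (suc n)

X : Series
X = shift 𝟙

⊕-congˡ : ∀ a {b b′} → b ≗ b′ → a ⊕ b ≗ a ⊕ b′
⊕-congˡ a b≗b′ n = cong (_+_ (a n)) (b≗b′ n)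

⊕-congʳ : ∀ b {a a′} → a ≗ a′ → a ⊕ b ≗ a′ ⊕ b
⊕-congʳ b a≗a′ n = cong (_+ b n) (a≗a′ n)

⊝-cong : ∀ {a a′} → a ≗ a′ → ⊝ a ≗ ⊝ a′
⊝-cong a≗a′ n = cong -_ (a≗a′ n)

⋆-congˡ : ∀ {a a′} b → a ≗ a′ → a ⋆ b ≗ a′ ⋆ b
⋆-congˡ b a≗a′ n = sumTo-cong n (λ {k} _ → cong (_* b (n ∸ k)) (a≗a′ k))

⋆-congʳ : ∀ a {b b′} → b ≗ b′ → a ⋆ b ≗ a ⋆ b′
⋆-congʳ a b≗b′ n = sumTo-cong n (λ {k} _ → cong (a k *_) (b≗b′ (n ∸ k)))

⋆-cong : ∀ {a a′ b b′} → a ≗ a′ → b ≗ b′ → a ⋆ b ≗ a′ ⋆ b′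
⋆-cong {a′ = a′} {b = b} a≗a′ b≗b′ n = trans (⋆-congˡ b a≗a′ n) (⋆-congʳ a′ b≗b′ n)

⋆-comm : ∀ a b → a ⋆ b ≗ b ⋆ a
⋆-comm a b n = begin
  sumTo n (λ k → a k * b (n ∸ k))               ≡⟨ sumTo-reverse n _ ⟩
  sumTo n (λ k → a (n ∸ k) * b (n ∸ (n ∸ k)))   ≡⟨ sumTo-cong n swap ⟩
  sumTo n (λ k → b k * a (n ∸ k))               ∎
  where
  open ≡-Reasoning
  swap : ∀ {k} → k ≤ n → a (n ∸ k) * b (n ∸ (n ∸ k)) ≡ b k * a (n ∸ k)
  swap {k} k≤n = trans (ℤ.*-comm (a (n ∸ k)) _) (cong (λ j → b j * a (n ∸ k)) (ℕ.m∸[m∸n]≡n k≤n))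

⋆-distribʳ : ∀ c a b → (a ⊕ b) ⋆ c ≗ a ⋆ c ⊕ b ⋆ c
⋆-distribʳ c a b n =
  trans (sumTo-cong n (λ {k} _ → ℤ.*-distribʳ-+ (c (n ∸ k)) (a k) (b k))) (sumTo-+ n _ _)

⋆-distribˡ : ∀ c a b → c ⋆ (a ⊕ b) ≗ c ⋆ a ⊕ c ⋆ b
⋆-distribˡ c a b n =
  trans (sumTo-cong n (λ {k} _ → ℤ.*-distribˡ-+ (c k) (a (n ∸ k)) (b (n ∸ k)))) (sumTo-+ n _ _)

⋆-suc : ∀ a b n → (a ⋆ b) (suc n) ≡ a 0 * b (suc n) + (tail a ⋆ b) n
⋆-suc a b n = sumTo-suc n (λ k → a k * b (suc n ∸ k))

tail-⋆ : ∀ a b → tail (a ⋆ b) ≗ a 0 · tail b ⊕ tail a ⋆ b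
tail-⋆ a b = ⋆-suc a b

·-⋆ : ∀ c a b → (c · a) ⋆ b ≗ c · (a ⋆ b)
·-⋆ c a b n = trans (sumTo-cong n (λ {k} _ → ℤ.*-assoc c (a k) (b (n ∸ k)))) (sumTo-*ˡ n c _)

⋆-assoc : ∀ a b c → (a ⋆ b) ⋆ c ≗ a ⋆ (b ⋆ c)
⋆-assoc a b c zero    = ℤ.*-assoc (a 0) (b 0) (c 0)
⋆-assoc a b c (suc n) = begin
  ((a ⋆ b) ⋆ c) (suc n)
    ≡⟨ ⋆-suc (a ⋆ b) c n ⟩
  a₀b₀c + (tail (a ⋆ b) ⋆ c) n
    ≡⟨ cong (_+_ a₀b₀c) (⋆-congˡ c (tail-⋆ a b) n) ⟩
  a₀b₀c + ((a₀ · tail b ⊕ tail a ⋆ b) ⋆ c) n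
    ≡⟨ cong (_+_ a₀b₀c) (⋆-distribʳ c (a₀ · tail b) (tail a ⋆ b) n) ⟩
  a₀b₀c + (((a₀ · tail b) ⋆ c) n + ((tail a ⋆ b) ⋆ c) n)
    ≡⟨ cong (_+_ a₀b₀c) (cong₂ _+_ (·-⋆ a₀ (tail b) c n) (⋆-assoc (tail a) b c n)) ⟩
  a₀b₀c + (a₀ * (tail b ⋆ c) n + (tail a ⋆ (b ⋆ c)) n)
    ≡⟨ regroup a₀ (b 0) (c (suc n)) ((tail b ⋆ c) n) ((tail a ⋆ (b ⋆ c)) n) ⟩
  a₀ * (b 0 * c (suc n) + (tail b ⋆ c) n) + (tail a ⋆ (b ⋆ c)) n
    ≡⟨ cong (λ x → a₀ * x + (tail a ⋆ (b ⋆ c)) n) (⋆-suc b c n) ⟨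
  a₀ * (b ⋆ c) (suc n) + (tail a ⋆ (b ⋆ c)) n
    ≡⟨ ⋆-suc a (b ⋆ c) n ⟨
  (a ⋆ (b ⋆ c)) (suc n) ∎
  where
  open ≡-Reasoning
  a₀ = a 0
  a₀b₀c = a₀ * b 0 * c (suc n)
  regroup : ∀ x y w u v → x * y * w + (x * u + v) ≡ x * (y * w + u) + v
  regroup = solve-∀

const-⋆ : ∀ c a → const c ⋆ a ≗ c · a
const-⋆ c a zero    = refl
const-⋆ c a (suc n) = begin
  (const c ⋆ a) (suc n)                          ≡⟨ ⋆-suc (const c) a n ⟩
  c * a (suc n) + sumTo n (λ k → 0ℤ * a (n ∸ k)) ≡⟨ cong (λ x → c * a (suc n) + x) (sumTo-zero n) ⟩
  c * a (suc n) + 0ℤ                             ≡⟨ ℤ.+-identityʳ _ ⟩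
  c * a (suc n)                                  ∎
  where open ≡-Reasoning

⋆-identityˡ : ∀ a → 𝟙 ⋆ a ≗ a
⋆-identityˡ a n = trans (const-⋆ 1ℤ a n) (ℤ.*-identityˡ (a n))

⋆-zeroʳ : ∀ a → a ⋆ 𝟘 ≗ 𝟘
⋆-zeroʳ a n = trans (sumTo-cong n (λ {k} _ → ℤ.*-zeroʳ (a k))) (sumTo-zero n)

shift-⋆ : ∀ a b → shift a ⋆ b ≗ shift (a ⋆ b)
shift-⋆ a b zero    = refl
shift-⋆ a b (suc n) = trans (⋆-suc (shift a) b n) (ℤ.+-identityˡ ((a ⋆ b) n))

shift≗X⋆ : ∀ a → shift a ≗ X ⋆ a
shift≗X⋆ a zero    = refl
shift≗X⋆ a (suc n) = sym (trans (shift-⋆ 𝟙 a (suc n)) (⋆-identityˡ a n))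

⊕-isAbelianGroup : IsAbelianGroup _≗_ _⊕_ 𝟘 ⊝_
⊕-isAbelianGroup = record
  { isGroup = record
    { isMonoid = record
      { isSemigroup = record
        { isMagma = record
          { isEquivalence = Setoid.isEquivalence (ℕ →-setoid ℤ)
          ; ∙-cong        = λ a≗a′ b≗b′ n → cong₂ _+_ (a≗a′ n) (b≗b′ n)
          }
        ; assoc = λ a b c n → ℤ.+-assoc (a n) (b n) (c n)
        }
      ; identity = (λ a n → ℤ.+-identityˡ (a n)) , (λ a n → ℤ.+-identityʳ (a n))
      }
    ; inverse = (λ a n → ℤ.+-inverseˡ (a n)) , (λ a n → ℤ.+-inverseʳ (a n))
    ; ⁻¹-cong = ⊝-cong
    }
  ; comm = λ a b n → ℤ.+-comm (a n) (b n)
  }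

seriesRing : CommutativeRing 0ℓ 0ℓ
seriesRing = record
  { Carrier           = Series
  ; _≈_               = _≗_
  ; _+_               = _⊕_
  ; _*_               = _⋆_
  ; -_                = ⊝_
  ; 0#                = 𝟘
  ; 1#                = 𝟙
  ; isCommutativeRing = record
    { isRing = record
      { +-isAbelianGroup = ⊕-isAbelianGroup
      ; *-cong           = ⋆-cong
      ; *-assoc          = ⋆-assoc
      ; *-identity       = ⋆-identityˡ , (λ a n → trans (⋆-comm a 𝟙 n) (⋆-identityˡ a n))
      ; distrib          = ⋆-distribˡ , ⋆-distribʳ
      }
    ; *-comm = ⋆-comm
    }
  }

constHom : CommutativeRing.rawRing ℤ.+-*-commutativeRing
             ACR.-Raw-AlmostCommutative⟶ ACR.fromCommutativeRing seriesRing
constHom = record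
  { ⟦_⟧    = const
  ; +-homo = λ { a b zero → refl ; a b (suc n) → refl }
  ; *-homo = λ a b n → sym (trans (const-⋆ a (const b) n) (*-const a b n))
  ; -‿homo = λ { a zero → refl ; a (suc n) → refl }
  ; 0-homo = λ { zero → refl ; (suc n) → refl }
  ; 1-homo = λ n → refl
  }
  where
  *-const : ∀ a b n → a * const b n ≡ const (a * b) n
  *-const a b zero    = refl
  *-const a b (suc n) = ℤ.*-zeroʳ a

const-≟ : ∀ a b → Maybe (const a ≗ const b)
const-≟ a b with a ℤ.≟ b
... | yes refl = just (λ _ → refl)
... | no  _    = nothing

open import Algebra.Solver.Ring _ _ constHom const-≟
  using (solve; _:=_; _:+_; _:*_; _:-_; con)

module ≗-Reasoning = SetoidReasoning (ℕ →-setoid ℤ)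
open Setoid (ℕ →-setoid ℤ) using () renaming (sym to ≗-sym; trans to ≗-trans)

≗-modulo : ∀ {p q l r} c → p ≗ q ⊕ c ⋆ (l ⊕ ⊝ r) → l ≗ r → p ≗ q
≗-modulo {p} {q} {l} {r} c p≗q+c[l-r] l≗r n = begin
  p n                       ≡⟨ p≗q+c[l-r] n ⟩
  q n + (c ⋆ (l ⊕ ⊝ r)) n   ≡⟨ cong (_+_ (q n)) (trans (⋆-congʳ c l-r≗𝟘 n) (⋆-zeroʳ c n)) ⟩
  q n + 0ℤ                  ≡⟨ ℤ.+-identityʳ (q n) ⟩
  q n                       ∎
  where
  open ≡-Reasoning
  l-r≗𝟘 : l ⊕ ⊝ r ≗ 𝟘
  l-r≗𝟘 m = ℤ.i≡j⇒i-j≡0 (l≗r m)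

private
  coefficients-vanish : ∀ {c a} → c 0 ≢ 0ℤ → a ⋆ c ≗ 𝟘 → ∀ n {k} → k ≤ n → a k ≡ 0ℤ
  coefficients-vanish {c} {a} c₀≢0 a⋆c≗𝟘 = go
    where
    leading : ∀ {i} → i * c 0 ≡ 0ℤ → i ≡ 0ℤ
    leading {i} i*c₀≡0 with ℤ.i*j≡0⇒i≡0∨j≡0 i i*c₀≡0
    ... | inj₁ i≡0  = i≡0
    ... | inj₂ c₀≡0 = contradiction c₀≡0 c₀≢0

    go : ∀ n {k} → k ≤ n → a k ≡ 0ℤ
    go zero    z≤n   = leading (a⋆c≗𝟘 0)
    go (suc n) k≤1+n with ℕ.m≤n⇒m<n∨m≡n k≤1+n
    ... | inj₁ (s≤s k≤n) = go n k≤n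
    ... | inj₂ refl      = leading (begin
      a (suc n) * c 0             ≡⟨ cong (λ j → a (suc n) * c j) (ℕ.n∸n≡0 n) ⟨
      a (suc n) * c (n ∸ n)       ≡⟨ ℤ.+-identityˡ _ ⟨
      0ℤ + a (suc n) * c (n ∸ n)  ≡⟨ cong (_+ a (suc n) * c (n ∸ n)) earlier-terms ⟨
      (a ⋆ c) (suc n)             ≡⟨ a⋆c≗𝟘 (suc n) ⟩
      0ℤ                          ∎)
      where
      open ≡-Reasoning
      earlier-terms : sumTo n (λ k → a k * c (suc n ∸ k)) ≡ 0ℤ
      earlier-terms = trans (sumTo-cong n (λ {k} k≤n → cong (_* c (suc n ∸ k)) (go n k≤n)))
                            (sumTo-zero n)

⋆-cancelˡ : ∀ c {a b} → c 0 ≢ 0ℤ → c ⋆ a ≗ c ⋆ b → a ≗ b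
⋆-cancelˡ c {a} {b} c₀≢0 c⋆a≗c⋆b n =
  ℤ.i-j≡0⇒i≡j (a n) (b n) (coefficients-vanish {c} {a ⊕ ⊝ b} c₀≢0 [a-b]⋆c≗𝟘 n ℕ.≤-refl)
  where
  [a-b]⋆c≗𝟘 : (a ⊕ ⊝ b) ⋆ c ≗ 𝟘
  [a-b]⋆c≗𝟘 m = trans (solve 3 (λ a b c → (a :- b) :* c := c :* a :- c :* b) (λ _ → refl) a b c m)
                      (ℤ.i≡j⇒i-j≡0 (c⋆a≗c⋆b m))

-- Words avoiding DUD

-- The state records the part of the word read so far that can still start an occurrence
-- of DUD: nothing, a final D, or a final DU.
data State : Set where
  neutral afterD afterDU : State

afterU : State → State
afterU neutral = neutral
afterU afterD  = afterDU
afterU afterDU = neutral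

afterU-afterU : ∀ s → afterU (afterU s) ≡ neutral
afterU-afterU neutral = refl
afterU-afterU afterD  = refl
afterU-afterU afterDU = refl

history : State → List Step
history neutral = []
history afterD  = D ∷ []
history afterDU = D ∷ U ∷ []

dudFree : State → List Step → Bool
dudFree s       []      = true
dudFree s       (U ∷ w) = dudFree (afterU s) w
dudFree afterDU (D ∷ w) = false
dudFree s       (D ∷ w) = dudFree afterD w

dudFree-correct : ∀ s w → dudFree s w ≡ not (containsDUD (history s ++ w))
dudFree-correct neutral []      = refl
dudFree-correct afterD  []      = refl
dudFree-correct afterDU []      = refl
dudFree-correct neutral (U ∷ w) = dudFree-correct neutral w
dudFree-correct afterD  (U ∷ w) = dudFree-correct afterDU w
dudFree-correct afterDU (U ∷ w) = dudFree-correct neutral w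
dudFree-correct neutral (D ∷ w) = dudFree-correct afterD w
dudFree-correct afterD  (D ∷ w) = dudFree-correct afterD w
dudFree-correct afterDU (D ∷ w) = refl

whenD : State → ℤ → ℤ
whenD afterDU _ = 0ℤ
whenD _       x = x

whenD-0 : ∀ s → whenD s 0ℤ ≡ 0ℤ
whenD-0 neutral = refl
whenD-0 afterD  = refl
whenD-0 afterDU = refl

paths : ℕ → ℕ → State → ℤ
paths zero    zero    s = 1ℤ
paths zero    (suc b) s = whenD s (paths zero b afterD)
paths (suc a) zero    s = paths a zero (afterU s)
paths (suc a) (suc b) s = paths a (suc b) (afterU s) + whenD s (paths (suc a) b afterD)

count : (List Step → Bool) → List (List Step) → ℕ
count P ws = length (filter (λ w → P w ≟B true) ws)

count-cong : ∀ {P P′} → (∀ w → P w ≡ P′ w) → ∀ ws → count P ws ≡ count P′ ws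
count-cong          P≡P′ []       = refl
count-cong {P} {P′} P≡P′ (w ∷ ws) with P w | P′ w | P≡P′ w
... | true  | .true  | refl = cong suc (count-cong P≡P′ ws)
... | false | .false | refl = count-cong P≡P′ ws

count-false : ∀ {P} → (∀ w → P w ≡ false) → ∀ ws → count P ws ≡ 0
count-false P≡false ws = trans (count-cong P≡false ws) (count-none ws)
  where
  count-none : ∀ ws → count (λ _ → false) ws ≡ 0
  count-none []       = refl
  count-none (_ ∷ ws) = count-none ws

count-words-suc : ∀ P k → + count P (words (suc k)) ≡
                          + count (P ∘ (U ∷_)) (words k) + + count (P ∘ (D ∷_)) (words k)
count-words-suc P k = trans (cong +_ (split (words k))) (ℤ.pos-+ (count (P ∘ (U ∷_)) (words k)) _)
  where
  split : ∀ ws → count P (concatMap (λ w → (U ∷ w) ∷ (D ∷ w) ∷ []) ws)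
                 ≡ count (P ∘ (U ∷_)) ws ℕ.+ count (P ∘ (D ∷_)) ws
  split []       = refl
  split (w ∷ ws) with P (U ∷ w)
  ... | true  with P (D ∷ w)
  ...   | true  = cong suc (trans (cong suc (split ws)) (sym (ℕ.+-suc _ _)))
  ...   | false = cong suc (split ws)
  split (w ∷ ws) | false with P (D ∷ w)
  ...   | true  = trans (cong suc (split ws)) (sym (ℕ.+-suc _ _))
  ...   | false = split ws

admissible : ℕ → ℕ → State → List Step → Bool
admissible a b s w = (countU w ≡ᵇ a) ∧ (countD w ≡ᵇ b) ∧ dudFree s w

count-up-zero : ∀ b s ws → count (admissible zero b s ∘ (U ∷_)) ws ≡ 0
count-up-zero b s = count-false (λ _ → refl)

count-down-zero : ∀ a s ws → count (admissible a zero s ∘ (D ∷_)) ws ≡ 0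
count-down-zero a s = count-false (λ w → ∧-zeroʳ (countU w ≡ᵇ a))

count-down : ∀ a b s ws → + count (admissible a (suc b) s ∘ (D ∷_)) ws ≡
                          whenD s (+ count (admissible a b afterD) ws)
count-down a b neutral ws = refl
count-down a b afterD  ws = refl
count-down a b afterDU ws = cong +_ (count-false never ws)
  where
  never : ∀ w → admissible a (suc b) afterDU (D ∷ w) ≡ false
  never w = trans (cong ((countU w ≡ᵇ a) ∧_) (∧-zeroʳ (countD w ≡ᵇ b))) (∧-zeroʳ _)

count-admissible : ∀ {k} a b s → a ℕ.+ b ≡ k → + count (admissible a b s) (words k) ≡ paths a b s
count-admissible {zero}  zero    zero    neutral refl = refl
count-admissible {zero}  zero    zero    afterD  refl = refl
count-admissible {zero}  zero    zero    afterDU refl = refl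
count-admissible {suc k} (suc a) zero    s a+0≡k = begin
  + count (admissible (suc a) zero s) (words (suc k))
    ≡⟨ count-words-suc _ k ⟩
  + count (admissible a zero (afterU s)) (words k) + + count (admissible (suc a) zero s ∘ (D ∷_)) (words k)
    ≡⟨ cong₂ _+_ (count-admissible a zero (afterU s) (ℕ.suc-injective a+0≡k))
                 (cong +_ (count-down-zero (suc a) s (words k))) ⟩
  paths a zero (afterU s) + 0ℤ
    ≡⟨ ℤ.+-identityʳ _ ⟩
  paths (suc a) zero s ∎
  where open ≡-Reasoning
count-admissible {suc k} zero    (suc b) s b≡k = begin
  + count (admissible zero (suc b) s) (words (suc k))
    ≡⟨ count-words-suc _ k ⟩
  + count (admissible zero (suc b) s ∘ (U ∷_)) (words k) + + count (admissible zero (suc b) s ∘ (D ∷_)) (words k)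
    ≡⟨ cong₂ _+_ (cong +_ (count-up-zero (suc b) s (words k))) (count-down zero b s (words k)) ⟩
  0ℤ + whenD s (+ count (admissible zero b afterD) (words k))
    ≡⟨ cong (λ x → 0ℤ + whenD s x) (count-admissible zero b afterD (ℕ.suc-injective b≡k)) ⟩
  0ℤ + paths zero (suc b) s
    ≡⟨ ℤ.+-identityˡ _ ⟩
  paths zero (suc b) s ∎
  where open ≡-Reasoning
count-admissible {suc k} (suc a) (suc b) s a+1+b≡k = begin
  + count (admissible (suc a) (suc b) s) (words (suc k))
    ≡⟨ count-words-suc _ k ⟩
  + count (admissible a (suc b) (afterU s)) (words k) + + count (admissible (suc a) (suc b) s ∘ (D ∷_)) (words k)
    ≡⟨ cong₂ _+_ (count-admissible a (suc b) (afterU s) (ℕ.suc-injective a+1+b≡k))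
                 (count-down (suc a) b s (words k)) ⟩
  paths a (suc b) (afterU s) + whenD s (+ count (admissible (suc a) b afterD) (words k))
    ≡⟨ cong (λ x → paths a (suc b) (afterU s) + whenD s x)
            (count-admissible (suc a) b afterD (trans (sym (ℕ.+-suc a b)) (ℕ.suc-injective a+1+b≡k))) ⟩
  paths (suc a) (suc b) s ∎
  where open ≡-Reasoning

g-suc≡paths : ∀ m → + g (suc m) ≡ paths m (suc m) neutral
g-suc≡paths m = begin
  + count (valid (suc m)) (words (suc k))
    ≡⟨ count-words-suc _ k ⟩
  + count (valid (suc m) ∘ (U ∷_)) (words k) + + count (valid (suc m) ∘ (D ∷_)) (words k)
    ≡⟨ cong₂ _+_ (cong +_ (count-cong first-up (words k))) (cong +_ (count-false first-down (words k))) ⟩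
  + count (admissible m (suc m) neutral) (words k) + 0ℤ
    ≡⟨ ℤ.+-identityʳ _ ⟩
  + count (admissible m (suc m) neutral) (words k)
    ≡⟨ count-admissible m (suc m) neutral refl ⟩
  paths m (suc m) neutral ∎
  where
  open ≡-Reasoning
  k = m ℕ.+ suc m
  first-up : ∀ w → valid (suc m) (U ∷ w) ≡ admissible m (suc m) neutral w
  first-up w = cong (λ x → (countU w ≡ᵇ m) ∧ (countD w ≡ᵇ suc m) ∧ x) (sym (dudFree-correct neutral w))
  first-down : ∀ w → valid (suc m) (D ∷ w) ≡ false
  first-down w = trans (cong ((countU (D ∷ w) ≡ᵇ suc m) ∧_) (∧-zeroʳ (countD w ≡ᵇ m))) (∧-zeroʳ _)

-- Paths relative to their final height

descent : ℕ → State → Series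
descent h s n = paths n (h ℕ.+ n) s

ascent : ℕ → State → Series
ascent d s n = paths (d ℕ.+ n) n s

-- Paths from height h to height 0 that never go below 0, by number of up steps; a path
-- ending in a state that forbids D gets weight 0, so that a step below 0 may follow it.
above : ℕ → State → Series
above zero    s zero    = whenD s 1ℤ
above zero    s (suc n) = above 1 (afterU s) n
above (suc h) s zero    = whenD s (above h afterD zero)
above (suc h) s (suc n) = above (suc (suc h)) (afterU s) n + whenD s (above h afterD (suc n))

-- Paths from depth d up to height 0 that never go above 0, by number of down steps.
below : ℕ → State → Series
below zero    s zero    = 1ℤ
below zero    s (suc n) = whenD s (below 1 afterD n)
below (suc d) s zero    = below d (afterU s) zero
below (suc d) s (suc n) = below d (afterU s) (suc n) + whenD s (below (suc (suc d)) afterD n)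

-- Q and R count the paths after their first step, an up step for Q and a down step for R.
Q R A B P₁ P₂ N₀ N₁ N₂ : Series
Q  = descent 1 neutral
R  = ascent 1 afterD
A  = above 0 neutral
B  = above 0 afterD
P₁ = above 1 neutral
P₂ = above 2 neutral
N₀ = below 0 neutral
N₁ = below 1 afterD
N₂ = below 2 afterD

descent-zero : ∀ s → descent 0 s ≗ shift (descent 1 (afterU s)) ⊕ (𝟙 ⊕ whenD s ∘ shift R)
descent-zero s zero    = sym (cong (_+_ 0ℤ) (trans (cong (_+_ 1ℤ) (whenD-0 s)) (ℤ.+-identityʳ 1ℤ)))
descent-zero s (suc n) = sym (cong (_+_ (descent 1 (afterU s) n)) (ℤ.+-identityˡ _))

descent-suc : ∀ h s → descent (suc h) s ≗ shift (descent (suc (suc h)) (afterU s)) ⊕ whenD s ∘ descent h afterD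
descent-suc h s zero    = sym (ℤ.+-identityˡ _)
descent-suc h s (suc n) =
  cong (λ b → paths n (suc b) (afterU s) + whenD s (descent h afterD (suc n))) (ℕ.+-suc h n)

ascent-suc : ∀ d s → ascent (suc d) s ≗ ascent d (afterU s) ⊕ whenD s ∘ shift (ascent (suc (suc d)) afterD)
ascent-suc d s zero    = sym (trans (cong (_+_ (ascent d (afterU s) 0)) (whenD-0 s)) (ℤ.+-identityʳ _))
ascent-suc d s (suc n) =
  cong (λ a → ascent d (afterU s) (suc n) + whenD s (paths (suc a) n afterD)) (ℕ.+-suc d n)

above-zero : ∀ s → above 0 s ≗ shift (above 1 (afterU s)) ⊕ whenD s ∘ 𝟙
above-zero s zero    = sym (ℤ.+-identityˡ _)
above-zero s (suc n) = sym (trans (cong (_+_ (above 1 (afterU s) n)) (whenD-0 s)) (ℤ.+-identityʳ _))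

above-suc : ∀ h s → above (suc h) s ≗ shift (above (suc (suc h)) (afterU s)) ⊕ whenD s ∘ above h afterD
above-suc h s zero    = sym (ℤ.+-identityˡ _)
above-suc h s (suc n) = refl

below-zero : ∀ s → below 0 s ≗ 𝟙 ⊕ whenD s ∘ shift (below 1 afterD)
below-zero s zero    = sym (trans (cong (_+_ 1ℤ) (whenD-0 s)) (ℤ.+-identityʳ _))
below-zero s (suc n) = sym (ℤ.+-identityˡ _)

below-suc : ∀ d s → below (suc d) s ≗ below d (afterU s) ⊕ whenD s ∘ shift (below (suc (suc d)) afterD)
below-suc d s zero    = sym (trans (cong (_+_ (below d (afterU s) 0)) (whenD-0 s)) (ℤ.+-identityʳ _))
below-suc d s (suc n) = refl

whenD-⋆ : ∀ s a b → (whenD s ∘ a) ⋆ b ≗ whenD s ∘ (a ⋆ b)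
whenD-⋆ neutral a b n = refl
whenD-⋆ afterD  a b n = refl
whenD-⋆ afterDU a b n = sumTo-zero n

⊕-whenD-⋆ : ∀ s a b c → (a ⊕ whenD s ∘ b) ⋆ c ≗ a ⋆ c ⊕ whenD s ∘ (b ⋆ c)
⊕-whenD-⋆ s a b c n = trans (⋆-distribʳ c a (whenD s ∘ b) n)
                            (cong (_+_ ((a ⋆ c) n)) (whenD-⋆ s b c n))

shift-⊕-whenD-⋆ : ∀ s a b c → (shift a ⊕ whenD s ∘ b) ⋆ c ≗ shift (a ⋆ c) ⊕ whenD s ∘ (b ⋆ c)
shift-⊕-whenD-⋆ s a b c n = trans (⊕-whenD-⋆ s (shift a) b c n)
                                  (cong (_+ whenD s ((b ⋆ c) n)) (shift-⋆ a c n))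

⊕-whenD-shift-⋆ : ∀ s a b c → (a ⊕ whenD s ∘ shift b) ⋆ c ≗ a ⋆ c ⊕ whenD s ∘ shift (b ⋆ c)
⊕-whenD-shift-⋆ s a b c n = trans (⊕-whenD-⋆ s a (shift b) c n)
                                  (cong (λ x → (a ⋆ c) n + whenD s x) (shift-⋆ b c n))

mutual
  above-factor : ∀ h s → above (suc h) s ≗ above h s ⋆ B
  above-factor zero s n = begin
    above 1 s n
      ≡⟨ above-suc 0 s n ⟩
    shift (above 2 (afterU s)) n + whenD s (B n)
      ≡⟨ cong₂ _+_ (shift-above-factor n 1 (afterU s)) (cong (whenD s) (sym (⋆-identityˡ B n))) ⟩
    shift (above 1 (afterU s) ⋆ B) n + whenD s ((𝟙 ⋆ B) n)
      ≡⟨ shift-⊕-whenD-⋆ s (above 1 (afterU s)) 𝟙 B n ⟨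
    ((shift (above 1 (afterU s)) ⊕ whenD s ∘ 𝟙) ⋆ B) n
      ≡⟨ ⋆-congˡ B (above-zero s) n ⟨
    (above 0 s ⋆ B) n ∎
    where open ≡-Reasoning
  above-factor (suc h) s n = begin
    above (suc (suc h)) s n
      ≡⟨ above-suc (suc h) s n ⟩
    shift (above (3 ℕ.+ h) (afterU s)) n + whenD s (above (suc h) afterD n)
      ≡⟨ cong₂ _+_ (shift-above-factor n (2 ℕ.+ h) (afterU s)) (cong (whenD s) (above-factor h afterD n)) ⟩
    shift (above (2 ℕ.+ h) (afterU s) ⋆ B) n + whenD s ((above h afterD ⋆ B) n)
      ≡⟨ shift-⊕-whenD-⋆ s (above (2 ℕ.+ h) (afterU s)) (above h afterD) B n ⟨
    ((shift (above (2 ℕ.+ h) (afterU s)) ⊕ whenD s ∘ above h afterD) ⋆ B) n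
      ≡⟨ ⋆-congˡ B (above-suc h s) n ⟨
    (above (suc h) s ⋆ B) n ∎
    where open ≡-Reasoning

  shift-above-factor : ∀ n h s → shift (above (suc h) s) n ≡ shift (above h s ⋆ B) n
  shift-above-factor zero    h s = refl
  shift-above-factor (suc n) h s = above-factor h s n

-- At depth 0 the factorisation holds only in the states afterU s.
mutual
  below-factor : ∀ d s → below (suc (suc d)) s ≗ below (suc d) s ⋆ N₀
  below-factor d s n = begin
    below (2 ℕ.+ d) s n
      ≡⟨ below-suc (suc d) s n ⟩
    below (suc d) (afterU s) n + whenD s (shift (below (3 ℕ.+ d) afterD) n)
      ≡⟨ cong₂ _+_ (below-factor-afterU d s n) (cong (whenD s) (shift-below-factor n (suc d) afterD)) ⟩
    (below d (afterU s) ⋆ N₀) n + whenD s (shift (below (2 ℕ.+ d) afterD ⋆ N₀) n)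
      ≡⟨ ⊕-whenD-shift-⋆ s (below d (afterU s)) (below (2 ℕ.+ d) afterD) N₀ n ⟨
    ((below d (afterU s) ⊕ whenD s ∘ shift (below (2 ℕ.+ d) afterD)) ⋆ N₀) n
      ≡⟨ ⋆-congˡ N₀ (below-suc d s) n ⟨
    (below (suc d) s ⋆ N₀) n ∎
    where open ≡-Reasoning

  below-factor-afterU : ∀ d s → below (suc d) (afterU s) ≗ below d (afterU s) ⋆ N₀
  below-factor-afterU (suc d) s   = below-factor d (afterU s)
  below-factor-afterU zero    s n = begin
    below 1 t n
      ≡⟨ below-suc 0 t n ⟩
    below 0 (afterU t) n + whenD t (shift (below 2 afterD) n)
      ≡⟨ cong₂ _+_ (cong (λ u → below 0 u n) (afterU-afterU s))
                   (cong (whenD t) (shift-below-factor n 0 afterD)) ⟩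
    N₀ n + whenD t (shift (below 1 afterD ⋆ N₀) n)
      ≡⟨ cong (_+ whenD t (shift (below 1 afterD ⋆ N₀) n)) (⋆-identityˡ N₀ n) ⟨
    (𝟙 ⋆ N₀) n + whenD t (shift (below 1 afterD ⋆ N₀) n)
      ≡⟨ ⊕-whenD-shift-⋆ t 𝟙 (below 1 afterD) N₀ n ⟨
    ((𝟙 ⊕ whenD t ∘ shift (below 1 afterD)) ⋆ N₀) n
      ≡⟨ ⋆-congˡ N₀ (below-zero t) n ⟨
    (below 0 t ⋆ N₀) n ∎
    where
    open ≡-Reasoning
    t = afterU s

  shift-below-factor : ∀ n d s → shift (below (suc (suc d)) s) n ≡ shift (below (suc d) s ⋆ N₀) n
  shift-below-factor zero    d s = refl
  shift-below-factor (suc n) d s = below-factor d s n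

-- Cut a path at its first step below its final height; at height 0 this needs state afterD.
mutual
  descent-firstPassage : ∀ h s → descent (suc h) s ≗ above (suc h) s ⋆ (𝟙 ⊕ shift R)
  descent-firstPassage h s n = begin
    descent (suc h) s n
      ≡⟨ descent-suc h s n ⟩
    shift (descent (2 ℕ.+ h) (afterU s)) n + whenD s (descent h afterD n)
      ≡⟨ cong₂ _+_ (shift-descent-firstPassage n (suc h) (afterU s))
                   (cong (whenD s) (descent-firstPassage-afterD h n)) ⟩
    shift (above (2 ℕ.+ h) (afterU s) ⋆ W) n + whenD s ((above h afterD ⋆ W) n)
      ≡⟨ shift-⊕-whenD-⋆ s (above (2 ℕ.+ h) (afterU s)) (above h afterD) W n ⟨
    ((shift (above (2 ℕ.+ h) (afterU s)) ⊕ whenD s ∘ above h afterD) ⋆ W) n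
      ≡⟨ ⋆-congˡ W (above-suc h s) n ⟨
    (above (suc h) s ⋆ W) n ∎
    where
    open ≡-Reasoning
    W = 𝟙 ⊕ shift R

  descent-firstPassage-afterD : ∀ h → descent h afterD ≗ above h afterD ⋆ (𝟙 ⊕ shift R)
  descent-firstPassage-afterD (suc h)   = descent-firstPassage h afterD
  descent-firstPassage-afterD zero    n = begin
    descent 0 afterD n
      ≡⟨ descent-zero afterD n ⟩
    shift (descent 1 afterDU) n + W n
      ≡⟨ cong₂ _+_ (shift-descent-firstPassage n 0 afterDU) (sym (⋆-identityˡ W n)) ⟩
    shift (above 1 afterDU ⋆ W) n + (𝟙 ⋆ W) n
      ≡⟨ shift-⊕-whenD-⋆ afterD (above 1 afterDU) 𝟙 W n ⟨
    ((shift (above 1 afterDU) ⊕ whenD afterD ∘ 𝟙) ⋆ W) n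
      ≡⟨ ⋆-congˡ W (above-zero afterD) n ⟨
    (above 0 afterD ⋆ W) n ∎
    where
    open ≡-Reasoning
    W = 𝟙 ⊕ shift R

  shift-descent-firstPassage : ∀ n h s →
                               shift (descent (suc h) s) n ≡ shift (above (suc h) s ⋆ (𝟙 ⊕ shift R)) n
  shift-descent-firstPassage zero    h s = refl
  shift-descent-firstPassage (suc n) h s = descent-firstPassage h s n

-- Cut a path at its first step above its final height; at depth 0 this needs a state afterU s.
mutual
  ascent-firstPassage : ∀ d s → ascent (suc d) s ≗ below (suc d) s ⋆ (𝟙 ⊕ shift Q)
  ascent-firstPassage d s n = begin
    ascent (suc d) s n
      ≡⟨ ascent-suc d s n ⟩
    ascent d (afterU s) n + whenD s (shift (ascent (2 ℕ.+ d) afterD) n)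
      ≡⟨ cong₂ _+_ (ascent-firstPassage-afterU d s n)
                   (cong (whenD s) (shift-ascent-firstPassage n (suc d) afterD)) ⟩
    (below d (afterU s) ⋆ V) n + whenD s (shift (below (2 ℕ.+ d) afterD ⋆ V) n)
      ≡⟨ ⊕-whenD-shift-⋆ s (below d (afterU s)) (below (2 ℕ.+ d) afterD) V n ⟨
    ((below d (afterU s) ⊕ whenD s ∘ shift (below (2 ℕ.+ d) afterD)) ⋆ V) n
      ≡⟨ ⋆-congˡ V (below-suc d s) n ⟨
    (below (suc d) s ⋆ V) n ∎
    where
    open ≡-Reasoning
    V = 𝟙 ⊕ shift Q

  ascent-firstPassage-afterU : ∀ d s → ascent d (afterU s) ≗ below d (afterU s) ⋆ (𝟙 ⊕ shift Q)
  ascent-firstPassage-afterU (suc d) s   = ascent-firstPassage d (afterU s)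
  ascent-firstPassage-afterU zero    s n = begin
    ascent 0 t n
      ≡⟨ descent-zero t n ⟩
    shift (descent 1 (afterU t)) n + (𝟙 n + whenD t (shift R n))
      ≡⟨ cong₂ (λ u x → shift (descent 1 u) n + (𝟙 n + whenD t x)) (afterU-afterU s)
               (shift-ascent-firstPassage n 0 afterD) ⟩
    shift Q n + (𝟙 n + whenD t (shift (below 1 afterD ⋆ V) n))
      ≡⟨ x∙yz≈yx∙z (shift Q n) (𝟙 n) _ ⟩
    V n + whenD t (shift (below 1 afterD ⋆ V) n)
      ≡⟨ cong (_+ whenD t (shift (below 1 afterD ⋆ V) n)) (⋆-identityˡ V n) ⟨
    (𝟙 ⋆ V) n + whenD t (shift (below 1 afterD ⋆ V) n)
      ≡⟨ ⊕-whenD-shift-⋆ t 𝟙 (below 1 afterD) V n ⟨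
    ((𝟙 ⊕ whenD t ∘ shift (below 1 afterD)) ⋆ V) n
      ≡⟨ ⋆-congˡ V (below-zero t) n ⟨
    (below 0 t ⋆ V) n ∎
    where
    open ≡-Reasoning
    t = afterU s
    V = 𝟙 ⊕ shift Q

  shift-ascent-firstPassage : ∀ n d s →
                              shift (ascent (suc d) s) n ≡ shift (below (suc d) s ⋆ (𝟙 ⊕ shift Q)) n
  shift-ascent-firstPassage zero    d s = refl
  shift-ascent-firstPassage (suc n) d s = ascent-firstPassage d s n

-- Solving for the generating function

MotzkinEquation : Series → Set
MotzkinEquation e = e ≗ X ⋆ (𝟙 ⊕ e ⊕ e ⋆ e)

motzkin-unique : ∀ {e e′} → MotzkinEquation e → MotzkinEquation e′ → e ≗ e′
motzkin-unique {e} {e′} e-eq e′-eq = ⋆-cancelˡ c (λ ()) (begin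
  c ⋆ e
    ≈⟨ ≗-modulo 𝟙 (solve 3 (λ x e e′ → (con 1ℤ :- x :* (con 1ℤ :+ e :+ e′)) :* e :=
                                      (x :- x :* (e :* e′)) :+ con 1ℤ :* (e :- x :* (con 1ℤ :+ e :+ e :* e)))
                           (λ _ → refl) X e e′) e-eq ⟩
  X ⊕ ⊝ X ⋆ (e ⋆ e′)
    ≈⟨ ≗-modulo 𝟙 (solve 3 (λ x e e′ → (con 1ℤ :- x :* (con 1ℤ :+ e :+ e′)) :* e′ :=
                                      (x :- x :* (e :* e′)) :+ con 1ℤ :* (e′ :- x :* (con 1ℤ :+ e′ :+ e′ :* e′)))
                           (λ _ → refl) X e e′) e′-eq ⟨
  c ⋆ e′ ∎)
  where
  open ≗-Reasoning
  c = 𝟙 ⊕ ⊝ X ⋆ (𝟙 ⊕ e ⊕ e′)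

mutual-solutions-equal : ∀ {e u v} → e 0 ≡ 0ℤ → u ≗ e ⋆ (𝟙 ⊕ v) → v ≗ e ⋆ (𝟙 ⊕ u) → u ≗ v
mutual-solutions-equal {e} {u} {v} e₀≡0 u-eq v-eq = ⋆-cancelˡ (𝟙 ⊕ e) 1+e₀≢0 (begin
  (𝟙 ⊕ e) ⋆ u
    ≈⟨ ≗-modulo 𝟙 (solve 3 (λ e u v → (con 1ℤ :+ e) :* u :=
                                     (e :* (con 1ℤ :+ v) :+ e :* u) :+ con 1ℤ :* (u :- e :* (con 1ℤ :+ v)))
                           (λ _ → refl) e u v) u-eq ⟩
  e ⋆ (𝟙 ⊕ v) ⊕ e ⋆ u
    ≈⟨ ≗-modulo 𝟙 (solve 3 (λ e u v → e :* (con 1ℤ :+ v) :+ e :* u :=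
                                     (con 1ℤ :+ e) :* v :+ con 1ℤ :* (e :* (con 1ℤ :+ u) :- v))
                           (λ _ → refl) e u v) (≗-sym v-eq) ⟩
  (𝟙 ⊕ e) ⋆ v ∎)
  where
  open ≗-Reasoning
  1+e₀≢0 : 1ℤ + e 0 ≢ 0ℤ
  1+e₀≢0 rewrite e₀≡0 = λ ()

[1-3X][1+2u]²≗1+X : ∀ {e u} → MotzkinEquation e → u ≗ e ⋆ (𝟙 ⊕ u) →
                    (𝟙 ⊕ ⊝ const (+ 3) ⋆ X) ⋆ ((𝟙 ⊕ const (+ 2) ⋆ u) ⋆ (𝟙 ⊕ const (+ 2) ⋆ u)) ≗ 𝟙 ⊕ X
[1-3X][1+2u]²≗1+X {e} {u} e-eq u-eq = ⋆-cancelˡ c c₀≢0 (begin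
  c ⋆ (a ⋆ (w ⋆ w))
    ≈⟨ solve 3 (λ x e u → ((con 1ℤ :- e) :* (con 1ℤ :- e)) :*
                          ((con 1ℤ :- con (+ 3) :* x) :* ((con 1ℤ :+ con (+ 2) :* u) :* (con 1ℤ :+ con (+ 2) :* u))) :=
                          (con 1ℤ :- con (+ 3) :* x) :* (((con 1ℤ :- e) :* (con 1ℤ :+ con (+ 2) :* u)) :*
                                                         ((con 1ℤ :- e) :* (con 1ℤ :+ con (+ 2) :* u))))
               (λ _ → refl) X e u ⟩
  a ⋆ (((𝟙 ⊕ ⊝ e) ⋆ w) ⋆ ((𝟙 ⊕ ⊝ e) ⋆ w))
    ≈⟨ ⋆-congʳ a (⋆-cong [1-e]w≗1+e [1-e]w≗1+e) ⟩
  a ⋆ ((𝟙 ⊕ e) ⋆ (𝟙 ⊕ e))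
    ≈⟨ ≗-modulo (const (+ 4)) (solve 2 (λ x e →
         (con 1ℤ :- con (+ 3) :* x) :* ((con 1ℤ :+ e) :* (con 1ℤ :+ e)) :=
         ((con 1ℤ :- e) :* (con 1ℤ :- e)) :* (con 1ℤ :+ x) :+ con (+ 4) :* (e :- x :* (con 1ℤ :+ e :+ e :* e)))
         (λ _ → refl) X e) e-eq ⟩
  c ⋆ (𝟙 ⊕ X) ∎)
  where
  open ≗-Reasoning
  a = 𝟙 ⊕ ⊝ const (+ 3) ⋆ X
  w = 𝟙 ⊕ const (+ 2) ⋆ u
  c = (𝟙 ⊕ ⊝ e) ⋆ (𝟙 ⊕ ⊝ e)
  c₀≢0 : c 0 ≢ 0ℤ
  c₀≢0 rewrite e-eq 0 = λ ()
  [1-e]w≗1+e : (𝟙 ⊕ ⊝ e) ⋆ w ≗ 𝟙 ⊕ e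
  [1-e]w≗1+e = ≗-modulo (const (+ 2)) (solve 2 (λ e u →
    (con 1ℤ :- e) :* (con 1ℤ :+ con (+ 2) :* u) := (con 1ℤ :+ e) :+ con (+ 2) :* (u :- e :* (con 1ℤ :+ u)))
    (λ _ → refl) e u) u-eq

square-root-unique : ∀ {s t} → s 0 ≡ 1ℤ → t 0 ≡ 1ℤ → s ⋆ s ≗ t ⋆ t → s ≗ t
square-root-unique {s} {t} s₀≡1 t₀≡1 s²≗t² = ⋆-cancelˡ (s ⊕ t) s₀+t₀≢0 (≗-modulo 𝟙
  (solve 2 (λ s t → (s :+ t) :* s := (s :+ t) :* t :+ con 1ℤ :* (s :* s :- t :* t)) (λ _ → refl) s t)
  s²≗t²)
  where
  s₀+t₀≢0 : s 0 + t 0 ≢ 0ℤ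
  s₀+t₀≢0 rewrite s₀≡1 | t₀≡1 = λ ()

A-unfold : A ≗ X ⋆ P₁ ⊕ 𝟙
A-unfold = ≗-trans (above-zero neutral) (⊕-congʳ 𝟙 (shift≗X⋆ P₁))

B-unfold : B ≗ X ⋆ (X ⋆ P₂) ⊕ 𝟙
B-unfold = ≗-trans (above-zero afterD) (⊕-congʳ 𝟙 (≗-trans (shift≗X⋆ _) (⋆-congʳ X above₁)))
  where
  above₁ : above 1 afterDU ≗ X ⋆ P₂
  above₁ n = trans (above-suc 0 afterDU n) (trans (ℤ.+-identityʳ _) (shift≗X⋆ P₂ n))

N₀-unfold : N₀ ≗ 𝟙 ⊕ X ⋆ N₁
N₀-unfold = ≗-trans (below-zero neutral) (⊕-congˡ 𝟙 (shift≗X⋆ N₁))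

N₁-unfold : N₁ ≗ 𝟙 ⊕ X ⋆ N₂
N₁-unfold = ≗-trans (below-suc 0 afterD) (≗-trans (⊕-congʳ _ below₀) (⊕-congˡ 𝟙 (shift≗X⋆ N₂)))
  where
  below₀ : below 0 afterDU ≗ 𝟙
  below₀ n = trans (below-zero afterDU n) (ℤ.+-identityʳ (𝟙 n))

motzkin-above : MotzkinEquation (X ⋆ P₁)
motzkin-above = ≗-trans E≗F (begin
  F
    ≈⟨ ⋆-congʳ X (⋆-congʳ (E ⊕ 𝟙) B-expanded) ⟩
  X ⋆ ((E ⊕ 𝟙) ⋆ (X ⋆ (X ⋆ (P₁ ⋆ B)) ⊕ 𝟙))
    ≈⟨ solve 3 (λ x p b → x :* ((x :* p :+ con 1ℤ) :* (x :* (x :* (p :* b)) :+ con 1ℤ)) :=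
                          x :* (x :* p :+ con 1ℤ) :+ (x :* (x :* p)) :* (x :* ((x :* p :+ con 1ℤ) :* b)))
               (λ _ → refl) X P₁ B ⟩
  X ⋆ (E ⊕ 𝟙) ⊕ (X ⋆ E) ⋆ F
    ≈⟨ ⊕-congˡ (X ⋆ (E ⊕ 𝟙)) (⋆-congʳ (X ⋆ E) E≗F) ⟨
  X ⋆ (E ⊕ 𝟙) ⊕ (X ⋆ E) ⋆ E
    ≈⟨ solve 2 (λ x e → x :* (e :+ con 1ℤ) :+ (x :* e) :* e := x :* (con 1ℤ :+ e :+ e :* e))
               (λ _ → refl) X E ⟩
  X ⋆ (𝟙 ⊕ E ⊕ E ⋆ E) ∎)
  where
  open ≗-Reasoning
  E = X ⋆ P₁
  F = X ⋆ ((E ⊕ 𝟙) ⋆ B)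
  E≗F : E ≗ F
  E≗F = ⋆-congʳ X (≗-trans (above-factor 0 neutral) (⋆-congˡ B A-unfold))
  B-expanded : B ≗ X ⋆ (X ⋆ (P₁ ⋆ B)) ⊕ 𝟙
  B-expanded = ≗-trans B-unfold (⊕-congʳ 𝟙 (⋆-congʳ X (⋆-congʳ X (above-factor 1 neutral))))

motzkin-below : MotzkinEquation (X ⋆ N₁)
motzkin-below = begin
  X ⋆ N₁
    ≈⟨ ⋆-congʳ X N₁-unfold ⟩
  X ⋆ (𝟙 ⊕ X ⋆ N₂)
    ≈⟨ ⋆-congʳ X (⊕-congˡ 𝟙 (⋆-congʳ X (below-factor 0 afterD))) ⟩
  X ⋆ (𝟙 ⊕ X ⋆ (N₁ ⋆ N₀))
    ≈⟨ ⋆-congʳ X (⊕-congˡ 𝟙 (⋆-congʳ X (⋆-congʳ N₁ N₀-unfold))) ⟩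
  X ⋆ (𝟙 ⊕ X ⋆ (N₁ ⋆ (𝟙 ⊕ X ⋆ N₁)))
    ≈⟨ solve 2 (λ x n → x :* (con 1ℤ :+ x :* (n :* (con 1ℤ :+ x :* n))) :=
                        x :* (con 1ℤ :+ x :* n :+ (x :* n) :* (x :* n)))
               (λ _ → refl) X N₁ ⟩
  X ⋆ (𝟙 ⊕ X ⋆ N₁ ⊕ (X ⋆ N₁) ⋆ (X ⋆ N₁)) ∎
  where open ≗-Reasoning

G≗shift-Q : G ≗ shift Q
G≗shift-Q zero    = refl
G≗shift-Q (suc n) = g-suc≡paths n

G-equation : G ≗ (X ⋆ P₁) ⋆ (𝟙 ⊕ G)
G-equation = begin
  G                          ≈⟨ G≗shift-Q ⟩
  shift Q                    ≈⟨ shift-Q-eq ⟩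
  (X ⋆ P₁) ⋆ (𝟙 ⊕ shift R)   ≈⟨ ⋆-congʳ (X ⋆ P₁) (⊕-congˡ 𝟙 shift-Q≗shift-R) ⟨
  (X ⋆ P₁) ⋆ (𝟙 ⊕ shift Q)   ≈⟨ ⋆-congʳ (X ⋆ P₁) (⊕-congˡ 𝟙 G≗shift-Q) ⟨
  (X ⋆ P₁) ⋆ (𝟙 ⊕ G)         ∎
  where
  open ≗-Reasoning
  shift-Q-eq : shift Q ≗ (X ⋆ P₁) ⋆ (𝟙 ⊕ shift R)
  shift-Q-eq = ≗-trans (shift≗X⋆ Q) (≗-trans (⋆-congʳ X (descent-firstPassage 0 neutral))
                                             (≗-sym (⋆-assoc X P₁ (𝟙 ⊕ shift R))))
  shift-R-eq : shift R ≗ (X ⋆ P₁) ⋆ (𝟙 ⊕ shift Q)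
  shift-R-eq = ≗-trans (shift≗X⋆ R) (≗-trans (⋆-congʳ X (ascent-firstPassage 0 afterD))
    (≗-trans (≗-sym (⋆-assoc X N₁ (𝟙 ⊕ shift Q)))
             (⋆-congˡ (𝟙 ⊕ shift Q) (motzkin-unique motzkin-below motzkin-above))))
  shift-Q≗shift-R : shift Q ≗ shift R
  shift-Q≗shift-R = mutual-solutions-equal {X ⋆ P₁} refl shift-Q-eq shift-R-eq

poly-∷ : ∀ c d ds → poly (c ∷ d ∷ ds) ≗ const c ⊕ X ⋆ poly (d ∷ ds)
poly-∷ c d ds zero    = sym (ℤ.+-identityʳ c)
poly-∷ c d ds (suc n) = sym (trans (cong (_+_ 0ℤ) (sym (shift≗X⋆ (poly (d ∷ ds)) (suc n)))) (ℤ.+-identityˡ _))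

poly-[_] : ∀ c → poly (c ∷ []) ≗ const c
poly-[ c ] zero    = refl
poly-[ c ] (suc n) = refl

poly-linear : ∀ c d → poly (c ∷ d ∷ []) ≗ const c ⊕ X ⋆ const d
poly-linear c d = ≗-trans (poly-∷ c d []) (⊕-congˡ (const c) (⋆-congʳ X poly-[ d ]))

root : Series
root = numer₀ ⊖ (denom ⋆ G)

root-factor : root ≗ (𝟙 ⊕ ⊝ const (+ 3) ⋆ X) ⋆ (𝟙 ⊕ const (+ 2) ⋆ G)
root-factor = begin
  numer₀ ⊕ ⊝ (denom ⋆ G)
    ≈⟨ ≗-trans (⊕-congʳ (⊝ (denom ⋆ G)) (poly-linear _ _))
               (⊕-congˡ (𝟙 ⊕ X ⋆ const (- + 3)) (⊝-cong (⋆-congˡ G (poly-linear (- + 2) (+ 6))))) ⟩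
  (𝟙 ⊕ X ⋆ const (- + 3)) ⊕ ⊝ ((const (- + 2) ⊕ X ⋆ const (+ 6)) ⋆ G)
    ≈⟨ solve 2 (λ x g → (con 1ℤ :+ x :* con (- + 3)) :- (con (- + 2) :+ x :* con (+ 6)) :* g :=
                        (con 1ℤ :- con (+ 3) :* x) :* (con 1ℤ :+ con (+ 2) :* g)) (λ _ → refl) X G ⟩
  (𝟙 ⊕ ⊝ const (+ 3) ⋆ X) ⋆ (𝟙 ⊕ const (+ 2) ⋆ G) ∎
  where open ≗-Reasoning

root-squared : root ⋆ root ≗ disc
root-squared = begin
  root ⋆ root            ≈⟨ ⋆-cong root-factor root-factor ⟩
  (a ⋆ w) ⋆ (a ⋆ w)      ≈⟨ solve 2 (λ a w → (a :* w) :* (a :* w) := a :* (a :* (w :* w))) (λ _ → refl) a w ⟩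
  a ⋆ (a ⋆ (w ⋆ w))      ≈⟨ ⋆-congʳ a ([1-3X][1+2u]²≗1+X motzkin-above G-equation) ⟩
  a ⋆ (𝟙 ⊕ X)            ≈⟨ solve 1 (λ x → (con 1ℤ :- con (+ 3) :* x) :* (con 1ℤ :+ x) :=
                               con 1ℤ :+ x :* (con (- + 2) :+ x :* con (- + 3))) (λ _ → refl) X ⟩
  𝟙 ⊕ X ⋆ (const (- + 2) ⊕ X ⋆ const (- + 3))
                         ≈⟨ ≗-trans (poly-∷ _ _ _) (⊕-congˡ 𝟙 (⋆-congʳ X (poly-linear _ _))) ⟨
  disc                   ∎
  where
  open ≗-Reasoning
  a = 𝟙 ⊕ ⊝ const (+ 3) ⋆ X
  w = 𝟙 ⊕ const (+ 2) ⋆ G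

corollary1 : (S : Series) → IsSqrtDisc S →
    (n : ℕ) → (denom ⋆ G) n ≡ (numer₀ ⊖ S) n
corollary1 S (S₀≡1 , S²≗disc) = ≗-sym (begin
  numer₀ ⊕ ⊝ S       ≈⟨ ⊕-congˡ numer₀ (⊝-cong S≗root) ⟩
  numer₀ ⊕ ⊝ root    ≈⟨ solve 2 (λ p q → p :- (p :- q) := q) (λ _ → refl) numer₀ (denom ⋆ G) ⟩
  denom ⋆ G          ∎)
  where
  open ≗-Reasoning
  S≗root : S ≗ root
  S≗root = square-root-unique S₀≡1 refl (≗-trans S²≗disc (≗-sym root-squared))
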